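{- Let $\mathfrak{S}$ be a finite subset of $\mathbb{Z}^2$ and let $(H,\rho)$ be a Gessel pair with $H\subseteq\mathfrak{S}^*$, with sets of minus-, zero- and plus-paths $H_-$, $H_0$, $H_+$. For $P\subseteq H$ put $\Gamma(P)=\sum_{\pi\in P} x^{a(\pi)}y^{b(\pi)}t^{\ell(\pi)}z^{\rho(\pi)}$, where $(a(\pi),b(\pi))$ is the ending point and $\ell(\pi)$ the length of $\pi$. Then $$\Gamma(H_-)=[\Gamma(H)]_-,\qquad \Gamma(H_0)=[\Gamma(H)]_0,\qquad \Gamma(H_+)=[\Gamma(H)]_+,$$ where $\Gamma(H)=[\Gamma(H)]_-[\Gamma(H)]_0[\Gamma(H)]_+$ is the unique factorization of $\Gamma(H)$ with respect to $z$.
   Context: A path is a finite sequence of lattice points $(a_0,b_0),\dots,(a_n,b_n)$ in $\mathbb{Z}^2$ with $(a_0,b_0)=(0,0)$; its steps are $(a_i-a_{i-1},b_i-b_{i-1})$, $n$ is its length and $(a_n,b_n)$ its ending point. $\mathfrak{S}^*$ denotes the set of paths all of whose steps lie in $\mathfrak{S}$. The product of two paths is concatenation of their step sequences; the empty path $\varepsilon$ is the unit. A monoid is free if every element factors uniquely as a product of primes. A Gessel pair $(H,\rho)$ consists of a subset $H\subseteq\mathfrak{S}^*$ which is a free monoid under concatenation, together with a homomorphism $\rho:H\to\mathbb{Z}$. For $\sigma\in H$ with prime factorization $\sigma=h_1\cdots h_m$ in $H$, its $H$-heads are $h_1\cdots h_i$, $i=0,\dots,m$. A minus-path is an element of $H$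 that is either empty or has negative $\rho$ value strictly less than the $\rho$ values of all its other $H$-heads; a zero-path is an element of $H$ with $\rho$ value $0$ all of whose $H$-heads have nonnegative $\rho$ values; a plus-path is an element of $H$ all of whose nonempty $H$-heads have positive $\rho$ values. $H_-,H_0,H_+$ denote the sets of minus-, zero- and plus-paths. The series $\Gamma(P)$ lie in the field $K\langle\langle x,y,z,t\rangle\rangle$ of iterated Laurent series ($K=\mathbb{C}$), defined inductively as Laurent series in $t$ with coefficients in $K\langle\langle x,y,z\rangle\rangle$, etc.; elements have well-ordered support in reverse lexicographic order and an initial term (term of minimal order). Unique factorization with respect to $z$: every $h$ in this field with initial term $1$ can be written uniquely as $h=h_-h_0h_+$ with $h_-,h_0,h_+$ in the field, each with initial term $1$, such that apart from the initial term $h_-$ contains only negative powers of $z$, $h_0$ is independent of $z$, and $h_+$ contains only positive powers of $z$; these factors are denoted $[h]_-,[h]_0,[h]_+$. -}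

module Defs where

open import Data.Nat as ℕ using (ℕ; zero; suc; _∸_)
open import Data.Integer as ℤ using (ℤ; +_; 0ℤ; 1ℤ)
open import Data.Product using (Σ; ∃; _×_; _,_)
open import Data.Sum using (_⊎_)
open import Data.List using (List; []; _∷_; _++_; concat; concatMap; map; take; length; upTo; foldr)
open import Data.List.Relation.Unary.All using (All)
open import Data.List.Relation.Unary.Unique.Propositional using (Unique)
open import Data.List.Membership.Propositional using (_∈_)
open import Relation.Binary.PropositionalEquality using (_≡_; _≢_)
open import Relation.Nullary using (¬_; yes; no)
open import Data.Bool using (if_then_else_)
open import Relation.Nullary.Decidable using (⌊_⌋)

Step : Set
Step = ℤ × ℤ

-- a path is given by its sequence of steps (it starts at (0,0))
Path : Set
Path = List Step

endpoint : Path → ℤ × ℤ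
endpoint [] = (0ℤ , 0ℤ)
endpoint ((u , v) ∷ π) with endpoint π
... | (a , b) = (u ℤ.+ a , v ℤ.+ b)

_∈*_ : Path → List Step → Set
π ∈* S = All (_∈ S) π

IsPrime : (Path → Set) → Path → Set
IsPrime H σ = H σ × σ ≢ [] ×
  (∀ u v → H u → H v → u ≢ [] → v ≢ [] → σ ≢ u ++ v)

IsFactorization : (Path → Set) → Path → List Path → Set
IsFactorization H σ fs = All (IsPrime H) fs × concat fs ≡ σ

record GesselPair (S : List Step) : Set₁ where
  field
    H      : Path → Set
    ρ      : Path → ℤ
    H⊆S*   : ∀ π → H π → π ∈* S
    H-ε    : H []
    H-++   : ∀ σ τ → H σ → H τ → H (σ ++ τ)
    free-∃ : ∀ σ → H σ → Σ (List Path) (IsFactorization H σ)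
    free-! : ∀ σ fs gs → IsFactorization H σ fs → IsFactorization H σ gs → fs ≡ gs
    ρ-ε    : ρ [] ≡ 0ℤ
    ρ-++   : ∀ σ τ → H σ → H τ → ρ (σ ++ τ) ≡ ρ σ ℤ.+ ρ τ

module _ {S : List Step} (G : GesselPair S) where
  open GesselPair G

  Hminus : Path → Set
  Hminus σ = H σ × (σ ≡ [] ⊎ (ρ σ ℤ.< 0ℤ ×
    (∀ fs → IsFactorization H σ fs → ∀ i → i ℕ.< length fs →
       ρ σ ℤ.< ρ (concat (take i fs)))))

  Hzero : Path → Set
  Hzero σ = H σ × ρ σ ≡ 0ℤ ×
    (∀ fs → IsFactorization H σ fs → ∀ i → i ℕ.≤ length fs →
       0ℤ ℤ.≤ ρ (concat (take i fs)))

  Hplus : Path → Set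
  Hplus σ = H σ ×
    (∀ fs → IsFactorization H σ fs → ∀ i → i ℕ.≤ length fs →
       concat (take i fs) ≢ [] → 0ℤ ℤ.< ρ (concat (take i fs)))

-- Series: power series in t whose coefficients are Laurent polynomials
-- in x, y, z (integer coefficients).  A monomial (c , a , b , r) stands
-- for c x^a y^b z^r.

Mono : Set
Mono = ℤ × ℤ × ℤ × ℤ

LPoly : Set
LPoly = List Mono

coeff : LPoly → ℤ → ℤ → ℤ → ℤ
coeff [] a b r = 0ℤ
coeff ((c , a' , b' , r') ∷ p) a b r =
  (if ⌊ a' ℤ.≟ a ⌋ then (if ⌊ b' ℤ.≟ b ⌋ then (if ⌊ r' ℤ.≟ r ⌋ then c else 0ℤ) else 0ℤ) else 0ℤ)
  ℤ.+ coeff p a b r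

_⊗_ : LPoly → LPoly → LPoly
p ⊗ q = concatMap (λ { (c , a , b , r) →
          map (λ { (c' , a' , b' , r') → (c ℤ.* c' , a ℤ.+ a' , b ℤ.+ b' , r ℤ.+ r') }) q }) p

-- f n is the coefficient of t^n
Series : Set
Series = ℕ → LPoly

_⊛_ : Series → Series → Series
(f ⊛ g) n = concatMap (λ k → f k ⊗ g (n ∸ k)) (upTo (suc n))

_≈_ : Series → Series → Set
f ≈ g = ∀ n a b r → coeff (f n) a b r ≡ coeff (g n) a b r

IsΓ : (Path → ℤ) → (Path → Set) → Series → Set
IsΓ ρ P f = ∀ n a b r → ∃ λ (L : List Path) → Unique L ×
  (∀ π → (π ∈ L → P π × length π ≡ n × endpoint π ≡ (a , b) × ρ π ≡ r)
       × (P π × length π ≡ n × endpoint π ≡ (a , b) × ρ π ≡ r → π ∈ L)) ×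
  coeff (f n) a b r ≡ + length L

-- Initial term (reverse lexicographic: t, then z, then y, then x) and
-- the factors of the unique factorization with respect to z.

NonNegRevLex : ℤ → ℤ → ℤ → Set
NonNegRevLex a b r = 0ℤ ℤ.< r ⊎ (r ≡ 0ℤ × (0ℤ ℤ.< b ⊎ (b ≡ 0ℤ × 0ℤ ℤ.≤ a)))

-- f has initial term 1 (no negative powers of t occur in a Series)
InitialOne : Series → Set
InitialOne f = coeff (f 0) 0ℤ 0ℤ 0ℤ ≡ 1ℤ ×
  (∀ a b r → coeff (f 0) a b r ≢ 0ℤ → NonNegRevLex a b r)

IsInitialExp : ℕ → ℤ → ℤ → ℤ → Set
IsInitialExp n a b r = n ≡ 0 × a ≡ 0ℤ × b ≡ 0ℤ × r ≡ 0ℤ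

IsMinusFactor : Series → Set
IsMinusFactor f = InitialOne f ×
  (∀ n a b r → coeff (f n) a b r ≢ 0ℤ → IsInitialExp n a b r ⊎ r ℤ.< 0ℤ)

IsZeroFactor : Series → Set
IsZeroFactor f = InitialOne f ×
  (∀ n a b r → coeff (f n) a b r ≢ 0ℤ → r ≡ 0ℤ)

IsPlusFactor : Series → Set
IsPlusFactor f = InitialOne f ×
  (∀ n a b r → coeff (f n) a b r ≢ 0ℤ → IsInitialExp n a b r ⊎ 0ℤ ℤ.< r)

IsZFactorization : Series → Series → Series → Series → Set
IsZFactorization h h₋ h₀ h₊ =
  IsMinusFactor h₋ × IsZeroFactor h₀ × IsPlusFactor h₊ × h ≈ ((h₋ ⊛ h₀) ⊛ h₊)

{-# OPTIONS --safe #-}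

-- Every σ ∈ H is uniquely a concatenation σ₋ σ₀ σ₊ of a minus-, a zero- and a plus-path:
-- writing v k for the ρ-value of the k-th H-head of σ, cut the prime factorization of σ at
-- the first and at the last index where v is minimal.  A product of series that count path
-- families by (endpoint, ρ, length) counts the concatenations of those paths, so this
-- bijection gives Γ(H) = Γ(H₋) Γ(H₀) Γ(H₊).  The definitions of the three path classes
-- confine the powers of z in Γ(H₋), Γ(H₀), Γ(H₊) to the ranges required of the factors.

module Submission where

open import Defs

open import Algebra.Bundles using (CommutativeMonoid)
open import Data.Bool using (if_then_else_)
open import Data.Empty using (⊥-elim)
open import Data.Integer as ℤ using (ℤ; 0ℤ; 1ℤ; _+_; _*_)
import Data.Integer.Properties as ℤP
open import Algebra.Properties.CommutativeSemigroup ℤP.+-commutativeSemigroup using (interchange)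
open import Data.List
  using (List; []; _∷_; _++_; map; concat; concatMap; foldr; filter; length; take; drop; upTo; deduplicate)
import Data.List.Properties as LP
open import Data.List.Membership.Propositional using (_∈_; find; lose)
open import Data.List.Membership.Propositional.Properties
  using ( ∈-map⁺; ∈-map⁻; ∈-++⁺ˡ; ∈-++⁺ʳ; ∈-concatMap⁺; ∈-concatMap⁻; ∈-upTo⁺; ∈-upTo⁻
        ; ∈-filter⁺; ∈-filter⁻; deduplicate-∈⇔)
open import Data.List.Membership.Propositional.Properties.WithK using (unique∧set⇒bag)
open import Data.List.Relation.Binary.BagAndSetEquality using (∼bag⇒↭)
open import Data.List.Relation.Binary.Permutation.Propositional using (_↭_; ↭⇒↭ₛ)
import Data.List.Relation.Binary.Permutation.Propositional.Properties as ↭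
open import Data.List.Relation.Binary.Permutation.Setoid.Properties using (foldr-commMonoid)
open import Data.List.Relation.Unary.All as All using (All; []; _∷_)
import Data.List.Relation.Unary.All.Properties as AllP
open import Data.List.Relation.Unary.AllPairs using ([]; _∷_)
open import Data.List.Relation.Unary.Any using (here; there; any?)
open import Data.List.Relation.Unary.Unique.Propositional using (Unique)
import Data.List.Relation.Unary.Unique.Propositional.Properties as Unique
open import Data.List.Relation.Unary.Unique.DecPropositional.Properties using (deduplicate-!)
open import Data.Nat as ℕ using (ℕ; zero; suc; _∸_)
import Data.Nat.Properties as ℕP
open import Data.Product using (Σ; ∃; ∃₂; _×_; _,_; proj₁; proj₂)
import Data.Product.Properties as ×P
open import Data.Sum using (_⊎_; inj₁; inj₂)
open import Function.Base using (_∘_; case_of_)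
open import Function.Bundles using (Equivalence; mk⇔)
open import Relation.Binary.Definitions using (DecidableEquality)
open import Relation.Binary.PropositionalEquality
open import Relation.Nullary using (¬_; yes; no)
open import Relation.Nullary.Decidable using (⌊_⌋)
open import Relation.Unary using (Decidable)

∑ : {A : Set} → List A → (A → ℤ) → ℤ
∑ xs f = foldr _+_ 0ℤ (map f xs)

infix 5 ∑
syntax ∑ xs (λ x → e) = ∑[ x ∈ xs ] e

module _ {A : Set} where

  ∑-++ : ∀ (xs ys : List A) f → ∑ (xs ++ ys) f ≡ ∑ xs f + ∑ ys f
  ∑-++ [] ys f = sym (ℤP.+-identityˡ _)
  ∑-++ (x ∷ xs) ys f = trans (cong (f x +_) (∑-++ xs ys f)) (sym (ℤP.+-assoc (f x) _ _))

  ∑-cong : ∀ (xs : List A) {f g : A → ℤ} → (∀ {x} → x ∈ xs → f x ≡ g x) → ∑ xs f ≡ ∑ xs g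
  ∑-cong [] eq = refl
  ∑-cong (x ∷ xs) eq = cong₂ _+_ (eq (here refl)) (∑-cong xs (eq ∘ there))

  ∑-zero : ∀ (xs : List A) {f} → (∀ {x} → x ∈ xs → f x ≡ 0ℤ) → ∑ xs f ≡ 0ℤ
  ∑-zero [] eq = refl
  ∑-zero (x ∷ xs) eq = cong₂ _+_ (eq (here refl)) (∑-zero xs (eq ∘ there))

  ∑-+ : ∀ (xs : List A) f g → ∑[ x ∈ xs ] (f x + g x) ≡ ∑ xs f + ∑ xs g
  ∑-+ [] f g = refl
  ∑-+ (x ∷ xs) f g = trans (cong (f x + g x +_) (∑-+ xs f g)) (interchange (f x) (g x) _ _)

  ∑-*ˡ : ∀ (xs : List A) c f → ∑[ x ∈ xs ] (c * f x) ≡ c * ∑ xs f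
  ∑-*ˡ [] c f = sym (ℤP.*-zeroʳ c)
  ∑-*ˡ (x ∷ xs) c f = trans (cong (c * f x +_) (∑-*ˡ xs c f)) (sym (ℤP.*-distribˡ-+ c (f x) _))

  ∑-map : ∀ {B : Set} (g : A → B) xs f → ∑ (map g xs) f ≡ ∑[ x ∈ xs ] f (g x)
  ∑-map g [] f = refl
  ∑-map g (x ∷ xs) f = cong (f (g x) +_) (∑-map g xs f)

  ∑-concatMap : ∀ {B : Set} (g : B → List A) xs f → ∑ (concatMap g xs) f ≡ ∑[ x ∈ xs ] ∑ (g x) f
  ∑-concatMap g [] f = refl
  ∑-concatMap g (x ∷ xs) f = trans (∑-++ (g x) _ f) (cong (∑ (g x) f +_) (∑-concatMap g xs f))

  ∑-filter : ∀ {P : A → Set} (P? : Decidable P) xs {f} → (∀ {x} → ¬ P x → f x ≡ 0ℤ) →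
    ∑ (filter P? xs) f ≡ ∑ xs f
  ∑-filter P? [] f0 = refl
  ∑-filter P? (x ∷ xs) {f} f0 with P? x
  ... | yes _ = cong (f x +_) (∑-filter P? xs f0)
  ... | no ¬p = trans (∑-filter P? xs f0) (sym (trans (cong (_+ ∑ xs f) (f0 ¬p)) (ℤP.+-identityˡ _)))

  ∑-const-1 : ∀ (xs : List A) → ∑[ x ∈ xs ] 1ℤ ≡ ℤ.+ length xs
  ∑-const-1 [] = refl
  ∑-const-1 (x ∷ xs) = trans (cong (1ℤ +_) (∑-const-1 xs)) (sym (ℤP.pos-+ 1 (length xs)))

  ∑-single : ∀ {xs : List A} {x f} → Unique xs → x ∈ xs → (∀ {y} → y ∈ xs → y ≢ x → f y ≡ 0ℤ) →
    ∑ xs f ≡ f x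
  ∑-single {y ∷ ys} {f = f} (y∉ys ∷ _) (here refl) f0 =
    trans (cong (f y +_) (∑-zero ys (λ z∈ → f0 (there z∈) (λ z≡y → All.lookup y∉ys z∈ (sym z≡y)))))
          (ℤP.+-identityʳ _)
  ∑-single {y ∷ ys} (y∉ys ∷ ys!) (there x∈) f0 =
    trans (cong₂ _+_ (f0 (here refl) (λ y≡x → All.lookup y∉ys x∈ y≡x)) (∑-single ys! x∈ (f0 ∘ there)))
          (ℤP.+-identityˡ _)

  ∑-↭ : ∀ {xs ys : List A} f → xs ↭ ys → ∑ xs f ≡ ∑ ys f
  ∑-↭ f p = foldr-commMonoid CM.setoid CM.isCommutativeMonoid (↭⇒↭ₛ (↭.map⁺ f p))
    where module CM = CommutativeMonoid ℤP.+-0-commutativeMonoid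

Exps : Set
Exps = ℤ × ℤ × ℤ

_≟ₑ_ : DecidableEquality Exps
_≟ₑ_ = ×P.≡-dec ℤ._≟_ (×P.≡-dec ℤ._≟_ ℤ._≟_)

_⊕_ : Exps → Exps → Exps
(a , b , r) ⊕ (a' , b' , r') = (a + a' , b + b' , r + r')

-- An LPoly may repeat an exponent, so it is handled through its pairings with functions on
-- exponents: they depend only on its coefficients (⟪⟫-cong) and turn ⊗ into a double sum.
⟪_∣_⟫ : LPoly → (Exps → ℤ) → ℤ
⟪ p ∣ G ⟫ = ∑[ m ∈ p ] proj₁ m * G (proj₂ m)

coeffAt : LPoly → Exps → ℤ
coeffAt p (a , b , r) = coeff p a b r

δ : Exps → Exps → ℤ
δ (a , b , r) (a' , b' , r') =
  if ⌊ a' ℤ.≟ a ⌋ then (if ⌊ b' ℤ.≟ b ⌋ then (if ⌊ r' ℤ.≟ r ⌋ then 1ℤ else 0ℤ) else 0ℤ) else 0ℤ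

δ-refl : ∀ e → δ e e ≡ 1ℤ
δ-refl (a , b , r) with a ℤ.≟ a | b ℤ.≟ b | r ℤ.≟ r
... | yes _ | yes _ | yes _  = refl
... | yes _ | yes _ | no r≢r = ⊥-elim (r≢r refl)
... | yes _ | no b≢b | _     = ⊥-elim (b≢b refl)
... | no a≢a | _ | _         = ⊥-elim (a≢a refl)

δ-≢ : ∀ {t e} → e ≢ t → δ t e ≡ 0ℤ
δ-≢ {a , b , r} {a' , b' , r'} e≢t with a' ℤ.≟ a | b' ℤ.≟ b | r' ℤ.≟ r
... | yes refl | yes refl | yes refl = ⊥-elim (e≢t refl)
... | yes _ | yes _ | no _ = refl
... | yes _ | no _ | _     = refl
... | no _ | _ | _         = refl

coeff-∷ : ∀ c e p t → coeffAt ((c , e) ∷ p) t ≡ c * δ t e + coeffAt p t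
coeff-∷ c (a' , b' , r') p (a , b , r) with a' ℤ.≟ a | b' ℤ.≟ b | r' ℤ.≟ r
... | yes _ | yes _ | yes _ = cong (_+ coeff p a b r) (sym (ℤP.*-identityʳ c))
... | yes _ | yes _ | no _  = cong (_+ coeff p a b r) (sym (ℤP.*-zeroʳ c))
... | yes _ | no _ | _      = cong (_+ coeff p a b r) (sym (ℤP.*-zeroʳ c))
... | no _ | _ | _          = cong (_+ coeff p a b r) (sym (ℤP.*-zeroʳ c))

coeff-⟪⟫ : ∀ p t → coeffAt p t ≡ ⟪ p ∣ δ t ⟫
coeff-⟪⟫ [] t = refl
coeff-⟪⟫ ((c , e) ∷ p) t = trans (coeff-∷ c e p t) (cong (c * δ t e +_) (coeff-⟪⟫ p t))

⟪⟫-⊗ : ∀ p q G → ⟪ p ⊗ q ∣ G ⟫ ≡ ⟪ p ∣ (λ e → ⟪ q ∣ (λ e' → G (e ⊕ e')) ⟫) ⟫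
⟪⟫-⊗ p q G = trans (∑-concatMap _ p _) (∑-cong p λ {(c , e)} _ → begin
    ∑[ m ∈ map _ q ] proj₁ m * G (proj₂ m)          ≡⟨ ∑-map _ q _ ⟩
    ∑[ m ∈ q ] (c * proj₁ m) * G (e ⊕ proj₂ m)       ≡⟨ ∑-cong q (λ {m} _ → ℤP.*-assoc c (proj₁ m) _) ⟩
    ∑[ m ∈ q ] c * (proj₁ m * G (e ⊕ proj₂ m))       ≡⟨ ∑-*ˡ q c _ ⟩
    c * ⟪ q ∣ (λ e' → G (e ⊕ e')) ⟫                  ∎)
  where open ≡-Reasoning

⟪⟫-⊛ : ∀ f g n G → ⟪ (f ⊛ g) n ∣ G ⟫ ≡ ∑[ k ∈ upTo (suc n) ] ⟪ f k ⊗ g (n ∸ k) ∣ G ⟫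
⟪⟫-⊛ f g n G = ∑-concatMap (λ k → f k ⊗ g (n ∸ k)) (upTo (suc n)) _

⟪⟫-via-coeff : ∀ {D} p G → Unique D → (∀ {m} → m ∈ p → proj₂ m ∈ D) →
  ⟪ p ∣ G ⟫ ≡ ∑[ t ∈ D ] coeffAt p t * G t
⟪⟫-via-coeff {D} [] G D! p⊆D = sym (∑-zero D (λ {t} _ → ℤP.*-zeroˡ (G t)))
⟪⟫-via-coeff {D} ((c , e) ∷ p) G D! p⊆D = sym (begin
  ∑[ t ∈ D ] coeffAt ((c , e) ∷ p) t * G t
    ≡⟨ ∑-cong D (λ {t} _ → trans (cong (_* G t) (coeff-∷ c e p t))
                                 (ℤP.*-distribʳ-+ (G t) (c * δ t e) (coeffAt p t))) ⟩
  ∑[ t ∈ D ] (c * δ t e) * G t + coeffAt p t * G t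
    ≡⟨ ∑-+ D _ _ ⟩
  (∑[ t ∈ D ] (c * δ t e) * G t) + (∑[ t ∈ D ] coeffAt p t * G t)
    ≡⟨ cong₂ _+_ picks-e (sym (⟪⟫-via-coeff p G D! (p⊆D ∘ there))) ⟩
  c * G e + ⟪ p ∣ G ⟫ ∎)
  where
  open ≡-Reasoning
  picks-e : ∑[ t ∈ D ] (c * δ t e) * G t ≡ c * G e
  picks-e = begin
    ∑[ t ∈ D ] (c * δ t e) * G t   ≡⟨ ∑-single D! (p⊆D (here refl)) off-e ⟩
    (c * δ e e) * G e              ≡⟨ cong (λ d → (c * d) * G e) (δ-refl e) ⟩
    (c * 1ℤ) * G e                 ≡⟨ cong (_* G e) (ℤP.*-identityʳ c) ⟩
    c * G e                        ∎
    where
    off-e : ∀ {t} → t ∈ D → t ≢ e → (c * δ t e) * G t ≡ 0ℤ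
    off-e {t} _ t≢e = begin
      (c * δ t e) * G t   ≡⟨ cong (λ d → (c * d) * G t) (δ-≢ (t≢e ∘ sym)) ⟩
      (c * 0ℤ) * G t      ≡⟨ cong (_* G t) (ℤP.*-zeroʳ c) ⟩
      0ℤ * G t            ≡⟨ ℤP.*-zeroˡ (G t) ⟩
      0ℤ                  ∎

⟪⟫-cong : ∀ p q → (∀ t → coeffAt p t ≡ coeffAt q t) → ∀ G → ⟪ p ∣ G ⟫ ≡ ⟪ q ∣ G ⟫
⟪⟫-cong p q p≗q G = begin
  ⟪ p ∣ G ⟫                         ≡⟨ ⟪⟫-via-coeff p G D! (∈D ∘ ∈-++⁺ˡ ∘ ∈-map⁺ proj₂) ⟩
  ∑[ t ∈ D ] coeffAt p t * G t      ≡⟨ ∑-cong D (λ {t} _ → cong (_* G t) (p≗q t)) ⟩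
  ∑[ t ∈ D ] coeffAt q t * G t      ≡⟨ ⟪⟫-via-coeff q G D! (∈D ∘ ∈-++⁺ʳ _ ∘ ∈-map⁺ proj₂) ⟨
  ⟪ q ∣ G ⟫                         ∎
  where
  open ≡-Reasoning
  D : List Exps
  D = deduplicate _≟ₑ_ (map proj₂ p ++ map proj₂ q)
  D! : Unique D
  D! = deduplicate-! _≟ₑ_ _
  ∈D : ∀ {t} → t ∈ map proj₂ p ++ map proj₂ q → t ∈ D
  ∈D = Equivalence.to (deduplicate-∈⇔ _≟ₑ_)

module _ {A : Set} where

  unique-↭ : {xs ys : List A} → Unique xs → Unique ys →
    (∀ {x} → x ∈ xs → x ∈ ys) → (∀ {x} → x ∈ ys → x ∈ xs) → xs ↭ ys
  unique-↭ xs! ys! xs⊆ys ys⊆xs = ∼bag⇒↭ (unique∧set⇒bag xs! ys! (mk⇔ xs⊆ys ys⊆xs))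

  Unique-concatMap : ∀ {B : Set} {f : B → List A} {xs} → Unique xs → (∀ {x} → x ∈ xs → Unique (f x)) →
    (∀ {x x′ y} → x ∈ xs → x′ ∈ xs → y ∈ f x → y ∈ f x′ → x ≡ x′) → Unique (concatMap f xs)
  Unique-concatMap {xs = []} _ _ _ = []
  Unique-concatMap {f = f} {x ∷ xs} (x∉xs ∷ xs!) f! fibres-disjoint =
    Unique.++⁺ (f! (here refl)) rest! λ (y∈fx , y∈rest) →
      let x′ , x′∈xs , y∈fx′ = find (∈-concatMap⁻ f {xs = xs} y∈rest)
      in All.lookup x∉xs x′∈xs (fibres-disjoint (here refl) (there x′∈xs) y∈fx y∈fx′)
    where
    rest! : Unique (concatMap f xs)
    rest! = Unique-concatMap xs! (f! ∘ there) (λ p q → fibres-disjoint (there p) (there q))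

  take-++ˡ : ∀ (xs ys : List A) {k} → k ℕ.≤ length xs → take k (xs ++ ys) ≡ take k xs
  take-++ˡ xs ys {zero} _ = refl
  take-++ˡ (x ∷ xs) ys {suc k} k≤ = cong (x ∷_) (take-++ˡ xs ys (ℕ.s≤s⁻¹ k≤))

  take-++ʳ : ∀ (xs ys : List A) k → take (length xs ℕ.+ k) (xs ++ ys) ≡ xs ++ take k ys
  take-++ʳ [] ys k = refl
  take-++ʳ (x ∷ xs) ys k = cong (x ∷_) (take-++ʳ xs ys k)

  ++-cancel-length : ∀ {xs xs′ ys ys′ : List A} → length xs ≡ length xs′ → xs ++ ys ≡ xs′ ++ ys′ →
    xs ≡ xs′ × ys ≡ ys′
  ++-cancel-length {[]} {[]} _ eq = refl , eq
  ++-cancel-length {x ∷ xs} {x′ ∷ xs′} |xs|≡ eq with LP.∷-injective eq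
  ... | refl , eq′ with ++-cancel-length {xs} {xs′} (ℕP.suc-injective |xs|≡) eq′
  ...   | refl , ys≡ = refl , ys≡

  split₃ : ∀ (xs : List A) {i j} → i ℕ.≤ j → j ℕ.≤ length xs →
    ∃₂ λ ys zs → ∃ λ ws → xs ≡ ys ++ zs ++ ws × length ys ≡ i × length ys ℕ.+ length zs ≡ j
  split₃ xs {i} {j} i≤j j≤ = ys , zs , drop j xs , xs≡ , |ys| , |ys|+|zs|
    where
    ys zs : List A
    ys = take i (take j xs)
    zs = drop i (take j xs)
    xs≡ : xs ≡ ys ++ zs ++ drop j xs
    xs≡ = begin
      xs                          ≡⟨ LP.take++drop≡id j xs ⟨
      take j xs ++ drop j xs      ≡⟨ cong (_++ drop j xs) (LP.take++drop≡id i (take j xs)) ⟨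
      (ys ++ zs) ++ drop j xs     ≡⟨ LP.++-assoc ys zs (drop j xs) ⟩
      ys ++ zs ++ drop j xs       ∎
      where open ≡-Reasoning
    |take-j| : length (take j xs) ≡ j
    |take-j| = trans (LP.length-take j xs) (ℕP.m≤n⇒m⊓n≡m j≤)
    |ys| : length ys ≡ i
    |ys| = trans (LP.length-take i (take j xs)) (ℕP.m≤n⇒m⊓n≡m (subst (i ℕ.≤_) (sym |take-j|) i≤j))
    |ys|+|zs| : length ys ℕ.+ length zs ≡ j
    |ys|+|zs| = trans (sym (LP.length-++ ys)) (trans (cong length (LP.take++drop≡id i (take j xs))) |take-j|)

module _ {A : Set} where

  _·_ : (List A → Set) → (List A → Set) → List A → Set
  (P · Q) σ = ∃₂ λ a b → P a × Q b × σ ≡ a ++ b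

  ConcatInjective : (List A → Set) → (List A → Set) → Set
  ConcatInjective P Q = ∀ {a b a′ b′} → P a → Q b → P a′ → Q b′ → a ++ b ≡ a′ ++ b′ → a ≡ a′

  record Enumeration (P : List A → Set) : Set where
    field
      enum     : ℕ → List (List A)
      enum-!   : ∀ n → Unique (enum n)
      ∈-enum⁺ : ∀ {σ} → P σ → σ ∈ enum (length σ)
      ∈-enum⁻ : ∀ {n σ} → σ ∈ enum n → P σ × length σ ≡ n

  open Enumeration

  enum-↭ : ∀ {P Q} (E : Enumeration P) (F : Enumeration Q) →
    (∀ {σ} → P σ → Q σ) → (∀ {σ} → Q σ → P σ) → ∀ n → enum E n ↭ enum F n
  enum-↭ E F P⇒Q Q⇒P n = unique-↭ (enum-! E n) (enum-! F n) (transfer E F P⇒Q) (transfer F E Q⇒P)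
    where
    transfer : ∀ {P Q} (E : Enumeration P) (F : Enumeration Q) → (∀ {σ} → P σ → Q σ) →
      ∀ {σ} → σ ∈ enum E n → σ ∈ enum F n
    transfer E F P⇒Q σ∈ with ∈-enum⁻ E σ∈
    ... | Pσ , refl = ∈-enum⁺ F (P⇒Q Pσ)

  words : List A → ℕ → List (List A)
  words S zero = [] ∷ []
  words S (suc n) = concatMap (λ s → map (s ∷_) (words S n)) S

  ∈-words⁺ : ∀ {S σ} → All (_∈ S) σ → σ ∈ words S (length σ)
  ∈-words⁺ [] = here refl
  ∈-words⁺ {S} {s ∷ σ} (s∈S ∷ σ∈S*) =
    ∈-concatMap⁺ (λ t → map (t ∷_) (words S (length σ))) (lose s∈S (∈-map⁺ (s ∷_) (∈-words⁺ σ∈S*)))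

  ∈-words⁻ : ∀ {S} n {σ} → σ ∈ words S n → length σ ≡ n
  ∈-words⁻ zero (here refl) = refl
  ∈-words⁻ {S} (suc n) σ∈ with find (∈-concatMap⁻ (λ t → map (t ∷_) (words S n)) {xs = S} σ∈)
  ... | s , _ , σ∈′ with ∈-map⁻ (s ∷_) σ∈′
  ...   | τ , τ∈ , refl = cong suc (∈-words⁻ n τ∈)

  enumeration : DecidableEquality A → (S : List A) → ∀ {P} →
    (∀ {σ} → P σ → All (_∈ S) σ) → Decidable P → Enumeration P
  -- S may list a letter twice, hence the deduplication.
  enumeration _≟_ S P⊆S* P? = record
    { enum    = λ n → deduplicate _≟ₗ_ (filter P? (words S n))
    ; enum-!  = λ n → deduplicate-! _≟ₗ_ _
    ; ∈-enum⁺ = λ Pσ → Equivalence.to (deduplicate-∈⇔ _≟ₗ_) (∈-filter⁺ P? (∈-words⁺ (P⊆S* Pσ)) Pσ)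
    ; ∈-enum⁻ = λ {n} σ∈ →
        let σ∈words , Pσ = ∈-filter⁻ P? (Equivalence.from (deduplicate-∈⇔ _≟ₗ_) σ∈) in Pσ , ∈-words⁻ n σ∈words
    }
    where
    _≟ₗ_ : DecidableEquality (List A)
    _≟ₗ_ = LP.≡-dec _≟_

  _⊡_ : List (List A) → List (List A) → List (List A)
  xs ⊡ ys = concatMap (λ a → map (a ++_) ys) xs

  ∈-⊡⁻ : ∀ xs ys {σ} → σ ∈ xs ⊡ ys → ∃₂ λ a b → a ∈ xs × b ∈ ys × σ ≡ a ++ b
  ∈-⊡⁻ xs ys σ∈ with find (∈-concatMap⁻ _ {xs = xs} σ∈)
  ... | a , a∈ , σ∈ₐ with ∈-map⁻ (a ++_) σ∈ₐ
  ...   | b , b∈ , σ≡ = a , b , a∈ , b∈ , σ≡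

  _⊙_ : (ℕ → List (List A)) → (ℕ → List (List A)) → ℕ → List (List A)
  (E ⊙ F) n = concatMap (λ k → E k ⊡ F (n ∸ k)) (upTo (suc n))

  ∈-⊙⁺ : ∀ E F {n k a b} → k ℕ.≤ n → a ∈ E k → b ∈ F (n ∸ k) → a ++ b ∈ (E ⊙ F) n
  ∈-⊙⁺ E F {n} {k} {a} k≤n a∈ b∈ =
    ∈-concatMap⁺ _ (lose (∈-upTo⁺ (ℕ.s≤s k≤n)) (∈-concatMap⁺ _ (lose a∈ (∈-map⁺ (a ++_) b∈))))

  ∈-⊙⁻ : ∀ E F {n σ} → σ ∈ (E ⊙ F) n →
    ∃ λ k → k ℕ.≤ n × ∃₂ λ a b → a ∈ E k × b ∈ F (n ∸ k) × σ ≡ a ++ b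
  ∈-⊙⁻ E F {n} σ∈ with find (∈-concatMap⁻ _ {xs = upTo (suc n)} σ∈)
  ... | k , k∈ , σ∈ₖ = k , ℕ.s≤s⁻¹ (∈-upTo⁻ k∈) , ∈-⊡⁻ (E k) (F (n ∸ k)) σ∈ₖ

  enumeration-⊙ : ∀ {P Q} → Enumeration P → Enumeration Q → ConcatInjective P Q → Enumeration (P · Q)
  enumeration-⊙ {P} {Q} E F injective = record
    { enum    = enum E ⊙ enum F
    ; enum-!  = ⊙-!
    ; ∈-enum⁺ = ∈⁺
    ; ∈-enum⁻ = ∈⁻
    }
    where
    ∈⁺ : ∀ {σ} → (P · Q) σ → σ ∈ (enum E ⊙ enum F) (length σ)
    ∈⁺ (a , b , Pa , Qb , refl) rewrite LP.length-++ a {b} =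
      ∈-⊙⁺ (enum E) (enum F) (ℕP.m≤m+n (length a) (length b)) (∈-enum⁺ E Pa)
        (subst (λ k → b ∈ enum F k) (sym (ℕP.m+n∸m≡n (length a) (length b))) (∈-enum⁺ F Qb))

    ∈⁻ : ∀ {n σ} → σ ∈ (enum E ⊙ enum F) n → (P · Q) σ × length σ ≡ n
    ∈⁻ σ∈ with ∈-⊙⁻ (enum E) (enum F) σ∈
    ... | k , k≤n , a , b , a∈ , b∈ , refl with ∈-enum⁻ E a∈ | ∈-enum⁻ F b∈
    ...   | Pa , refl | Qb , |b|≡ =
      (a , b , Pa , Qb , refl) , trans (LP.length-++ a) (trans (cong (length a ℕ.+_) |b|≡) (ℕP.m+[n∸m]≡n k≤n))

    injective-on : ∀ {k k′ m m′ a a′ b b′} →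
      a ∈ enum E k → b ∈ enum F m → a′ ∈ enum E k′ → b′ ∈ enum F m′ → a ++ b ≡ a′ ++ b′ → a ≡ a′
    injective-on a∈ b∈ a′∈ b′∈ = injective (P-of a∈) (Q-of b∈) (P-of a′∈) (Q-of b′∈)
      where
      P-of : ∀ {k a} → a ∈ enum E k → P a
      P-of = proj₁ ∘ ∈-enum⁻ E
      Q-of : ∀ {m b} → b ∈ enum F m → Q b
      Q-of = proj₁ ∘ ∈-enum⁻ F

    ⊙-! : ∀ n → Unique ((enum E ⊙ enum F) n)
    ⊙-! n = Unique-concatMap (Unique.upTo⁺ (suc n)) (λ _ → ⊡-!) same-k
      where
      ⊡-! : ∀ {k} → Unique (enum E k ⊡ enum F (n ∸ k))
      ⊡-! {k} = Unique-concatMap (enum-! E k) (λ _ → Unique.map⁺ (LP.++-cancelˡ _ _ _) (enum-! F (n ∸ k)))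
        λ a∈ a′∈ σ∈ σ∈′ →
          let b , b∈ , σ≡ = ∈-map⁻ _ σ∈ ; b′ , b′∈ , σ≡′ = ∈-map⁻ _ σ∈′
          in injective-on a∈ b∈ a′∈ b′∈ (trans (sym σ≡) σ≡′)
      same-k : ∀ {k k′ σ} → k ∈ upTo (suc n) → k′ ∈ upTo (suc n) →
        σ ∈ enum E k ⊡ enum F (n ∸ k) → σ ∈ enum E k′ ⊡ enum F (n ∸ k′) → k ≡ k′
      same-k _ _ σ∈ σ∈′ with ∈-⊡⁻ _ _ σ∈ | ∈-⊡⁻ _ _ σ∈′
      ... | a , b , a∈ , b∈ , σ≡ | a′ , b′ , a′∈ , b′∈ , σ≡′
        with injective-on a∈ b∈ a′∈ b′∈ (trans (sym σ≡) σ≡′)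
      ...   | refl = trans (sym (proj₂ (∈-enum⁻ E a∈))) (proj₂ (∈-enum⁻ E a′∈))

open Enumeration

_≟ₛ_ : DecidableEquality Step
_≟ₛ_ = ×P.≡-dec ℤ._≟_ ℤ._≟_

_≟ₚ_ : DecidableEquality Path
_≟ₚ_ = LP.≡-dec _≟ₛ_

endpoint-++ : ∀ π τ →
  endpoint (π ++ τ) ≡ (proj₁ (endpoint π) + proj₁ (endpoint τ) , proj₂ (endpoint π) + proj₂ (endpoint τ))
endpoint-++ [] τ = sym (cong₂ _,_ (ℤP.+-identityˡ _) (ℤP.+-identityˡ _))
endpoint-++ ((u , w) ∷ π) τ = trans (cong (λ e → (u + proj₁ e , w + proj₂ e)) (endpoint-++ π τ))
                                    (cong₂ _,_ (sym (ℤP.+-assoc u _ _)) (sym (ℤP.+-assoc w _ _)))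

module Counting (ρ : Path → ℤ) where

  stat : Path → Exps
  stat π = (proj₁ (endpoint π) , proj₂ (endpoint π) , ρ π)

  -- A record rather than a function type, so that f and E can be inferred from a proof.
  record Counts (f : Series) (E : ℕ → List Path) : Set where
    constructor counts
    field ⟪⟫-≡ : ∀ n G → ⟪ f n ∣ G ⟫ ≡ ∑[ π ∈ E n ] G (stat π)

  module _ {P : Path → Set} (f : Series) (Γf : IsΓ ρ P f) where

    IsΓ-decidable : Decidable P
    IsΓ-decidable σ with Γf (length σ) (proj₁ (endpoint σ)) (proj₂ (endpoint σ)) (ρ σ)
    ... | L , _ , L-spec , _ with any? (σ ≟ₚ_) L
    ...   | yes σ∈L = yes (proj₁ (proj₁ (L-spec σ) σ∈L))
    ...   | no σ∉L  = no λ Pσ → σ∉L (proj₂ (L-spec σ) (Pσ , refl , refl , refl))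

    IsΓ-coeff : (E : Enumeration P) → ∀ n t → ∑[ π ∈ enum E n ] δ t (stat π) ≡ coeffAt (f n) t
    IsΓ-coeff E n t@(a , b , r) with Γf n a b r
    ... | L , L! , L-spec , coeff≡ = begin
      ∑[ π ∈ enum E n ] δ t (stat π)   ≡⟨ ∑-filter hit? (enum E n) δ-≢ ⟨
      ∑[ π ∈ hits ] δ t (stat π)       ≡⟨ ∑-cong hits (λ π∈ → trans (cong (δ t) (stat≡t π∈)) (δ-refl t)) ⟩
      ∑[ π ∈ hits ] 1ℤ                 ≡⟨ ∑-const-1 hits ⟩
      ℤ.+ length hits                  ≡⟨ cong ℤ.+_ (↭.↭-length (unique-↭ hits! L! hits⊆L L⊆hits)) ⟩
      ℤ.+ length L                     ≡⟨ coeff≡ ⟨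
      coeff (f n) a b r                ∎
      where
      open ≡-Reasoning
      hit? : Decidable (λ π → stat π ≡ t)
      hit? π = stat π ≟ₑ t
      hits : List Path
      hits = filter hit? (enum E n)
      hits! : Unique hits
      hits! = Unique.filter⁺ hit? (enum-! E n)
      stat≡t : ∀ {π} → π ∈ hits → stat π ≡ t
      stat≡t π∈ = proj₂ (∈-filter⁻ hit? {xs = enum E n} π∈)
      hits⊆L : ∀ {π} → π ∈ hits → π ∈ L
      hits⊆L π∈ with ∈-filter⁻ hit? π∈
      ... | π∈E , refl with ∈-enum⁻ E π∈E
      ...   | Pπ , |π|≡n = proj₂ (L-spec _) (Pπ , |π|≡n , refl , refl)
      L⊆hits : ∀ {π} → π ∈ L → π ∈ hits
      L⊆hits π∈ with proj₁ (L-spec _) π∈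
      ... | Pπ , refl , refl , refl = ∈-filter⁺ hit? (∈-enum⁺ E Pπ) refl

    IsΓ-counts : (E : Enumeration P) → Counts f (enum E)
    IsΓ-counts E = counts λ n G → trans (⟪⟫-cong (f n) (canonical n) (same-coeffs n) G) (⟪canonical⟫ n G)
      where
      canonical : ℕ → LPoly
      canonical n = map (λ π → (1ℤ , stat π)) (enum E n)
      ⟪canonical⟫ : ∀ n G → ⟪ canonical n ∣ G ⟫ ≡ ∑[ π ∈ enum E n ] G (stat π)
      ⟪canonical⟫ n G = trans (∑-map _ (enum E n) _) (∑-cong (enum E n) (λ _ → ℤP.*-identityˡ _))
      same-coeffs : ∀ n t → coeffAt (f n) t ≡ coeffAt (canonical n) t
      same-coeffs n t = begin
        coeffAt (f n) t                  ≡⟨ IsΓ-coeff E n t ⟨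
        ∑[ π ∈ enum E n ] δ t (stat π)   ≡⟨ ⟪canonical⟫ n (δ t) ⟨
        ⟪ canonical n ∣ δ t ⟫            ≡⟨ coeff-⟪⟫ (canonical n) t ⟨
        coeffAt (canonical n) t          ∎
        where open ≡-Reasoning

    IsΓ-support : ∀ {n a b r} → coeff (f n) a b r ≢ 0ℤ →
      ∃ λ π → P π × length π ≡ n × endpoint π ≡ (a , b) × ρ π ≡ r
    IsΓ-support {n} {a} {b} {r} coeff≢0 with Γf n a b r
    ... | [] , _ , _ , coeff≡0 = ⊥-elim (coeff≢0 coeff≡0)
    ... | π ∷ _ , _ , L-spec , _ = π , proj₁ (L-spec π) (here refl)

    IsΓ-initialOne : ρ [] ≡ 0ℤ → P [] → InitialOne f
    IsΓ-initialOne ρ-ε P[] = only-[] , nonnegative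
      where
      only-[] : coeff (f 0) 0ℤ 0ℤ 0ℤ ≡ 1ℤ
      only-[] with Γf 0 0ℤ 0ℤ 0ℤ
      ... | L , L! , L-spec , coeff≡ =
        trans coeff≡ (cong ℤ.+_ (↭.↭-length (unique-↭ L! ([] ∷ []) L⊆[[]] [[]]⊆L)))
        where
        L⊆[[]] : ∀ {π} → π ∈ L → π ∈ [] ∷ []
        L⊆[[]] {[]} _ = here refl
        L⊆[[]] {_ ∷ _} π∈ with proj₁ (L-spec _) π∈
        ... | _ , () , _
        [[]]⊆L : ∀ {π} → π ∈ [] ∷ [] → π ∈ L
        [[]]⊆L (here refl) = proj₂ (L-spec []) (P[] , refl , refl , ρ-ε)
      nonnegative : ∀ a b r → coeff (f 0) a b r ≢ 0ℤ → NonNegRevLex a b r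
      nonnegative a b r coeff≢0 with IsΓ-support coeff≢0
      ... | [] , _ , _ , refl , refl = inj₂ (ρ-ε , inj₂ (refl , ℤP.≤-refl))

  counts-⊛ : ∀ {P Q f g} (E : Enumeration P) (F : Enumeration Q) →
    (∀ {a b} → P a → Q b → stat (a ++ b) ≡ stat a ⊕ stat b) →
    Counts f (enum E) → Counts g (enum F) → Counts (f ⊛ g) (enum E ⊙ enum F)
  counts-⊛ {f = f} {g} E F stat-++ (counts f-counts) (counts g-counts) = counts λ n G → begin
    ⟪ (f ⊛ g) n ∣ G ⟫
      ≡⟨ ⟪⟫-⊛ f g n G ⟩
    ∑[ k ∈ upTo (suc n) ] ⟪ f k ⊗ g (n ∸ k) ∣ G ⟫
      ≡⟨ ∑-cong (upTo (suc n)) (λ {k} _ → block G k (n ∸ k)) ⟩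
    ∑[ k ∈ upTo (suc n) ] ∑[ σ ∈ enum E k ⊡ enum F (n ∸ k) ] G (stat σ)
      ≡⟨ ∑-concatMap (λ k → enum E k ⊡ enum F (n ∸ k)) (upTo (suc n)) _ ⟨
    ∑[ σ ∈ (enum E ⊙ enum F) n ] G (stat σ)
      ∎
    where
    open ≡-Reasoning
    block : ∀ G k m → ⟪ f k ⊗ g m ∣ G ⟫ ≡ ∑[ σ ∈ enum E k ⊡ enum F m ] G (stat σ)
    block G k m = begin
      ⟪ f k ⊗ g m ∣ G ⟫
        ≡⟨ ⟪⟫-⊗ (f k) (g m) G ⟩
      ⟪ f k ∣ (λ e → ⟪ g m ∣ (λ e′ → G (e ⊕ e′)) ⟫) ⟫
        ≡⟨ f-counts k _ ⟩
      ∑[ a ∈ enum E k ] ⟪ g m ∣ (λ e′ → G (stat a ⊕ e′)) ⟫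
        ≡⟨ ∑-cong (enum E k) (λ _ → g-counts m _) ⟩
      ∑[ a ∈ enum E k ] ∑[ b ∈ enum F m ] G (stat a ⊕ stat b)
        ≡⟨ ∑-cong (enum E k) (λ a∈ → ∑-cong (enum F m) (λ b∈ →
             cong G (sym (stat-++ (proj₁ (∈-enum⁻ E a∈)) (proj₁ (∈-enum⁻ F b∈)))))) ⟩
      ∑[ a ∈ enum E k ] ∑[ b ∈ enum F m ] G (stat (a ++ b))
        ≡⟨ ∑-cong (enum E k) (λ {a} _ → ∑-map (a ++_) (enum F m) _) ⟨
      ∑[ a ∈ enum E k ] ∑[ σ ∈ map (a ++_) (enum F m) ] G (stat σ)
        ≡⟨ ∑-concatMap (λ a → map (a ++_) (enum F m)) (enum E k) _ ⟨
      ∑[ σ ∈ enum E k ⊡ enum F m ] G (stat σ)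
        ∎

  counts-≈ : ∀ {f g E F} → Counts f E → Counts g F → (∀ n → E n ↭ F n) → f ≈ g
  counts-≈ {f} {g} {E} {F} (counts f-counts) (counts g-counts) E↭F n a b r = begin
    coeff (f n) a b r              ≡⟨ coeff-⟪⟫ (f n) t ⟩
    ⟪ f n ∣ δ t ⟫                  ≡⟨ f-counts n (δ t) ⟩
    ∑[ π ∈ E n ] δ t (stat π)      ≡⟨ ∑-↭ _ (E↭F n) ⟩
    ∑[ π ∈ F n ] δ t (stat π)      ≡⟨ g-counts n (δ t) ⟨
    ⟪ g n ∣ δ t ⟫                  ≡⟨ coeff-⟪⟫ (g n) t ⟨
    coeff (g n) a b r              ∎
    where
    open ≡-Reasoning
    t : Exps
    t = (a , b , r)

record IsFirstMinimum (v : ℕ → ℤ) (m i : ℕ) : Set where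
  field
    bound : i ℕ.≤ m
    least : ∀ k → k ℕ.≤ m → v i ℤ.≤ v k
    first : ∀ k → k ℕ.< i → v i ℤ.< v k

record IsLastMinimum (v : ℕ → ℤ) (m j : ℕ) : Set where
  field
    bound : j ℕ.≤ m
    least : ∀ k → k ℕ.≤ m → v j ℤ.≤ v k
    last  : ∀ k → j ℕ.< k → k ℕ.≤ m → v j ℤ.< v k

module First = IsFirstMinimum
module Last = IsLastMinimum

module _ {v : ℕ → ℤ} where

  first-minimum : ∀ m → ∃ (IsFirstMinimum v m)
  first-minimum zero = 0 , record { bound = ℕ.z≤n ; least = λ { .0 ℕ.z≤n → ℤP.≤-refl } ; first = λ _ () }
  first-minimum (suc m) with first-minimum m
  ... | i , i-min with v (suc m) ℤ.<? v i
  ...   | yes new = suc m , record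
    { bound = ℕP.≤-refl
    ; least = λ k k≤ → case ℕP.m≤n⇒m<n∨m≡n k≤ of λ where
        (inj₁ k<)   → ℤP.≤-trans (ℤP.<⇒≤ new) (First.least i-min k (ℕ.s≤s⁻¹ k<))
        (inj₂ refl) → ℤP.≤-refl
    ; first = λ k k< → ℤP.<-≤-trans new (First.least i-min k (ℕ.s≤s⁻¹ k<))
    }
  ...   | no old = i , record
    { bound = ℕP.m≤n⇒m≤1+n (First.bound i-min)
    ; least = λ k k≤ → case ℕP.m≤n⇒m<n∨m≡n k≤ of λ where
        (inj₁ k<)   → First.least i-min k (ℕ.s≤s⁻¹ k<)
        (inj₂ refl) → ℤP.≮⇒≥ old
    ; first = First.first i-min
    }

  last-minimum : ∀ m → ∃ (IsLastMinimum v m)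
  last-minimum zero =
    0 , record { bound = ℕ.z≤n ; least = λ { .0 ℕ.z≤n → ℤP.≤-refl } ; last = λ { _ () ℕ.z≤n } }
  last-minimum (suc m) with last-minimum m
  ... | j , j-min with v (suc m) ℤ.≤? v j
  ...   | yes new = suc m , record
    { bound = ℕP.≤-refl
    ; least = λ k k≤ → case ℕP.m≤n⇒m<n∨m≡n k≤ of λ where
        (inj₁ k<)   → ℤP.≤-trans new (Last.least j-min k (ℕ.s≤s⁻¹ k<))
        (inj₂ refl) → ℤP.≤-refl
    ; last = λ k m<k k≤m → ⊥-elim (ℕP.<⇒≱ m<k k≤m)
    }
  ...   | no old = j , record
    { bound = ℕP.m≤n⇒m≤1+n (Last.bound j-min)
    ; least = λ k k≤ → case ℕP.m≤n⇒m<n∨m≡n k≤ of λ where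
        (inj₁ k<)   → Last.least j-min k (ℕ.s≤s⁻¹ k<)
        (inj₂ refl) → ℤP.<⇒≤ (ℤP.≰⇒> old)
    ; last = λ k j<k k≤ → case ℕP.m≤n⇒m<n∨m≡n k≤ of λ where
        (inj₁ k<)   → Last.last j-min k j<k (ℕ.s≤s⁻¹ k<)
        (inj₂ refl) → ℤP.≰⇒> old
    }

  first-minimum-unique : ∀ {m i i′} → IsFirstMinimum v m i → IsFirstMinimum v m i′ → i ≡ i′
  first-minimum-unique i-min i′-min = ℕP.≤-antisym (no-earlier i-min i′-min) (no-earlier i′-min i-min)
    where
    no-earlier : ∀ {m i i′} → IsFirstMinimum v m i → IsFirstMinimum v m i′ → i ℕ.≤ i′
    no-earlier {i′ = i′} i-min i′-min =
      ℕP.≮⇒≥ λ i′<i → ℤP.<⇒≱ (First.first i-min i′ i′<i) (First.least i′-min _ (First.bound i-min))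

  last-minimum-unique : ∀ {m j j′} → IsLastMinimum v m j → IsLastMinimum v m j′ → j ≡ j′
  last-minimum-unique j-min j′-min = ℕP.≤-antisym (no-later j′-min j-min) (no-later j-min j′-min)
    where
    no-later : ∀ {m j j′} → IsLastMinimum v m j → IsLastMinimum v m j′ → j′ ℕ.≤ j
    no-later {j′ = j′} j-min j′-min =
      ℕP.≮⇒≥ λ j<j′ →
        ℤP.<⇒≱ (Last.last j-min j′ j<j′ (Last.bound j′-min)) (Last.least j′-min _ (Last.bound j-min))

  first≤last : ∀ {m i j} → IsFirstMinimum v m i → IsLastMinimum v m j → i ℕ.≤ j
  first≤last {j = j} i-min j-min =
    ℕP.≮⇒≥ λ j<i → ℤP.<⇒≱ (First.first i-min j j<i) (Last.least j-min _ (First.bound i-min))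

  minima-agree : ∀ {m i j} → IsFirstMinimum v m i → IsLastMinimum v m j → v j ≡ v i
  minima-agree i-min j-min =
    ℤP.≤-antisym (Last.least j-min _ (First.bound i-min)) (First.least i-min _ (Last.bound j-min))

data Region (a b : ℕ) : ℕ → Set where
  inA : ∀ {k} → k ℕ.< a → Region a b k
  inB : ∀ {k} → k ℕ.≤ b → Region a b (a ℕ.+ k)
  inC : ∀ k → Region a b (a ℕ.+ (b ℕ.+ suc k))

region : ∀ a b k → Region a b k
region (suc a) b zero = inA (ℕ.s≤s ℕ.z≤n)
region (suc a) b (suc k) with region a b k
... | inA k<a = inA (ℕ.s≤s k<a)
... | inB k≤b = inB k≤b
... | inC k′  = inC k′
region zero zero zero = inB ℕ.z≤n
region zero zero (suc k) = inC k
region zero (suc b) zero = inB ℕ.z≤n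
region zero (suc b) (suc k) with region zero b k
... | inB k≤b = inB (ℕ.s≤s k≤b)
... | inC k′  = inC k′

i≤i+j : ∀ i {j} → 0ℤ ℤ.≤ j → i ℤ.≤ i + j
i≤i+j i 0≤j = subst (ℤ._≤ i + _) (ℤP.+-identityʳ i) (ℤP.+-monoʳ-≤ i 0≤j)

i<i+j : ∀ i {j} → 0ℤ ℤ.< j → i ℤ.< i + j
i<i+j i 0<j = subst (ℤ._< i + _) (ℤP.+-identityʳ i) (ℤP.+-monoʳ-< i 0<j)

-i+[i+j]≡j : ∀ i j → ℤ.- i + (i + j) ≡ j
-i+[i+j]≡j i j = trans (sym (ℤP.+-assoc (ℤ.- i) i j)) (trans (cong (_+ j) (ℤP.+-inverseˡ i)) (ℤP.+-identityˡ j))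

+-cancelˡ-≤ : ∀ i {j k} → i + j ℤ.≤ i + k → j ℤ.≤ k
+-cancelˡ-≤ i le = subst₂ ℤ._≤_ (-i+[i+j]≡j i _) (-i+[i+j]≡j i _) (ℤP.+-monoʳ-≤ (ℤ.- i) le)

+-cancelˡ-< : ∀ i {j k} → i + j ℤ.< i + k → j ℤ.< k
+-cancelˡ-< i lt = subst₂ ℤ._<_ (-i+[i+j]≡j i _) (-i+[i+j]≡j i _) (ℤP.+-monoʳ-< (ℤ.- i) lt)

i+j≡i⇒j≡0 : ∀ i {j} → i + j ≡ i → j ≡ 0ℤ
i+j≡i⇒j≡0 i {j} eq = trans (sym (-i+[i+j]≡j i j)) (trans (cong (ℤ.- i +_) eq) (ℤP.+-inverseˡ i))

module Decomposition {S : List Step} (G : GesselPair S) where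
  open GesselPair G

  Primes : List Path → Set
  Primes = All (IsPrime H)

  H-concat : ∀ {fs} → Primes fs → H (concat fs)
  H-concat [] = H-ε
  H-concat (f-prime ∷ fs!) = H-++ _ _ (proj₁ f-prime) (H-concat fs!)

  concat≡[] : ∀ {fs} → Primes fs → concat fs ≡ [] → fs ≡ []
  concat≡[] [] _ = refl
  concat≡[] {f ∷ _} ((_ , f≢[] , _) ∷ _) eq = ⊥-elim (f≢[] (LP.++-conicalˡ f _ eq))

  factorization-unique : ∀ {fs gs} → Primes fs → IsFactorization H (concat fs) gs → gs ≡ fs
  factorization-unique fs! gs-fact = free-! _ _ _ gs-fact (fs! , refl)

  concat-++₃ : ∀ (A B C : List Path) → concat (A ++ B ++ C) ≡ concat A ++ concat B ++ concat C
  concat-++₃ A B C = trans (sym (LP.concat-++ A (B ++ C))) (cong (concat A ++_) (sym (LP.concat-++ B C)))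

  primes₃ : ∀ A B {C} → Primes (A ++ B ++ C) → Primes A × Primes B × Primes C
  primes₃ A B ABC! = AllP.++⁻ˡ A ABC! , AllP.++⁻ˡ B (AllP.++⁻ʳ A ABC!) , AllP.++⁻ʳ B (AllP.++⁻ʳ A ABC!)

  concat-take-suc≢[] : ∀ {fs k} → Primes fs → suc k ℕ.≤ length fs → concat (take (suc k) fs) ≢ []
  concat-take-suc≢[] {f ∷ _} ((_ , f≢[] , _) ∷ _) _ = f≢[] ∘ LP.++-conicalˡ f _

  heads : List Path → ℕ → ℤ
  heads fs k = ρ (concat (take k fs))

  heads-length : ∀ fs → heads fs (length fs) ≡ ρ (concat fs)
  heads-length fs = cong (ρ ∘ concat) (LP.take-all (length fs) fs ℕP.≤-refl)

  heads-++ˡ : ∀ fs gs {k} → k ℕ.≤ length fs → heads (fs ++ gs) k ≡ heads fs k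
  heads-++ˡ fs gs k≤ = cong (ρ ∘ concat) (take-++ˡ fs gs k≤)

  heads-++ʳ : ∀ {fs gs} → Primes fs → Primes gs → ∀ k →
    heads (fs ++ gs) (length fs ℕ.+ k) ≡ ρ (concat fs) + heads gs k
  heads-++ʳ {fs} {gs} fs! gs! k = begin
    ρ (concat (take (length fs ℕ.+ k) (fs ++ gs)))  ≡⟨ cong (ρ ∘ concat) (take-++ʳ fs gs k) ⟩
    ρ (concat (fs ++ take k gs))                    ≡⟨ cong ρ (LP.concat-++ fs (take k gs)) ⟨
    ρ (concat fs ++ concat (take k gs))             ≡⟨ ρ-++ _ _ (H-concat fs!) (H-concat (AllP.take⁺ k gs!)) ⟩
    ρ (concat fs) + heads gs k                      ∎
    where open ≡-Reasoning

  MinusHeads : List Path → Set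
  MinusHeads fs = ∀ k → k ℕ.< length fs → ρ (concat fs) ℤ.< heads fs k

  ZeroHeads : List Path → Set
  ZeroHeads fs = ρ (concat fs) ≡ 0ℤ × (∀ k → k ℕ.≤ length fs → 0ℤ ℤ.≤ heads fs k)

  PlusHeads : List Path → Set
  PlusHeads fs = ∀ k → k ℕ.≤ length fs → concat (take k fs) ≢ [] → 0ℤ ℤ.< heads fs k

  minus⇒heads : ∀ {fs} → Primes fs → Hminus G (concat fs) → MinusHeads fs
  minus⇒heads fs! (_ , inj₁ empty) k k< with concat≡[] fs! empty
  minus⇒heads fs! (_ , inj₁ empty) k () | refl
  minus⇒heads fs! (_ , inj₂ (_ , below)) = below _ (fs! , refl)

  heads⇒minus : ∀ {fs} → Primes fs → MinusHeads fs → Hminus G (concat fs)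
  heads⇒minus {[]} _ _ = H-ε , inj₁ refl
  heads⇒minus {fs@(_ ∷ _)} fs! below =
    H-concat fs! , inj₂ (subst (ρ (concat fs) ℤ.<_) ρ-ε (below 0 (ℕ.s≤s ℕ.z≤n)) ,
                         λ gs gs-fact → subst (λ gs → ∀ k → k ℕ.< length gs → ρ (concat fs) ℤ.< heads gs k)
                                              (sym (factorization-unique fs! gs-fact)) below)

  zero⇒heads : ∀ {fs} → Primes fs → Hzero G (concat fs) → ZeroHeads fs
  zero⇒heads fs! (_ , ρ≡0 , above) = ρ≡0 , above _ (fs! , refl)

  heads⇒zero : ∀ {fs} → Primes fs → ZeroHeads fs → Hzero G (concat fs)
  heads⇒zero fs! (ρ≡0 , above) =
    H-concat fs! , ρ≡0 ,
    λ gs gs-fact → proj₂ (subst ZeroHeads (sym (factorization-unique fs! gs-fact)) (ρ≡0 , above))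

  plus⇒heads : ∀ {fs} → Primes fs → Hplus G (concat fs) → PlusHeads fs
  plus⇒heads fs! (_ , above) = above _ (fs! , refl)

  heads⇒plus : ∀ {fs} → Primes fs → PlusHeads fs → Hplus G (concat fs)
  heads⇒plus fs! above = H-concat fs! , λ gs gs-fact → subst PlusHeads (sym (factorization-unique fs! gs-fact)) above

  module Pieces {A B C : List Path} (A! : Primes A) (B! : Primes B) (C! : Primes C) where
    a b c : ℕ
    a = length A
    b = length B
    c = length C

    ρA ρB : ℤ
    ρA = ρ (concat A)
    ρB = ρ (concat B)

    v : ℕ → ℤ
    v = heads (A ++ B ++ C)

    ℓ : ℕ
    ℓ = length (A ++ B ++ C)

    |ABC| : ℓ ≡ a ℕ.+ (b ℕ.+ c)
    |ABC| = trans (LP.length-++ A) (cong (a ℕ.+_) (LP.length-++ B))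

    v-A : ∀ {k} → k ℕ.≤ a → v k ≡ heads A k
    v-A = heads-++ˡ A (B ++ C)

    v-B : ∀ {k} → k ℕ.≤ b → v (a ℕ.+ k) ≡ ρA + heads B k
    v-B {k} k≤b = trans (heads-++ʳ A! (AllP.++⁺ B! C!) k) (cong (ρA +_) (heads-++ˡ B C k≤b))

    v-C : ∀ k → v (a ℕ.+ (b ℕ.+ k)) ≡ ρA + (ρB + heads C k)
    v-C k = trans (heads-++ʳ A! (AllP.++⁺ B! C!) (b ℕ.+ k)) (cong (ρA +_) (heads-++ʳ B! C! k))

    v-a : v a ≡ ρA
    v-a = trans (v-A ℕP.≤-refl) (heads-length A)

    v-ab : v (a ℕ.+ b) ≡ ρA + ρB
    v-ab = trans (v-B ℕP.≤-refl) (cong (ρA +_) (heads-length B))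

    inC-bound : ∀ {k} → a ℕ.+ (b ℕ.+ suc k) ℕ.≤ ℓ → suc k ℕ.≤ c
    inC-bound {k} le =
      ℕP.+-cancelˡ-≤ b _ _ (ℕP.+-cancelˡ-≤ a _ _ (subst (a ℕ.+ (b ℕ.+ suc k) ℕ.≤_) |ABC| le))

    pieces⇒minima : MinusHeads A → ZeroHeads B → PlusHeads C →
      IsFirstMinimum v ℓ a × IsLastMinimum v ℓ (a ℕ.+ b)
    pieces⇒minima below (ρB≡0 , B-above) C-above =
      record { bound = a≤ ; least = least ; first = first } ,
      record { bound = ab≤ ; least = λ k k≤ → subst (ℤ._≤ v k) (sym v-ab≡v-a) (least k k≤) ; last = last }
      where
      ab≤ : a ℕ.+ b ℕ.≤ ℓ
      ab≤ = subst (a ℕ.+ b ℕ.≤_) (sym |ABC|) (ℕP.+-monoʳ-≤ a (ℕP.m≤m+n b c))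
      a≤ : a ℕ.≤ ℓ
      a≤ = ℕP.≤-trans (ℕP.m≤m+n a b) ab≤
      v-ab≡v-a : v (a ℕ.+ b) ≡ v a
      v-ab≡v-a = trans v-ab (trans (cong (ρA +_) ρB≡0) (trans (ℤP.+-identityʳ ρA) (sym v-a)))
      C-positive : ∀ {k} → a ℕ.+ (b ℕ.+ suc k) ℕ.≤ ℓ → 0ℤ ℤ.< heads C (suc k)
      C-positive le = C-above _ (inC-bound le) (concat-take-suc≢[] C! (inC-bound le))
      first : ∀ k → k ℕ.< a → v a ℤ.< v k
      first k k<a = subst₂ ℤ._<_ (sym v-a) (sym (v-A (ℕP.<⇒≤ k<a))) (below k k<a)
      last : ∀ k → a ℕ.+ b ℕ.< k → k ℕ.≤ ℓ → v (a ℕ.+ b) ℤ.< v k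
      last k ab<k k≤ with region a b k
      ... | inA k<a = ⊥-elim (ℕP.<-asym k<a (ℕP.≤-<-trans (ℕP.m≤m+n a b) ab<k))
      ... | inB k≤b = ⊥-elim (ℕP.<⇒≱ ab<k (ℕP.+-monoʳ-≤ a k≤b))
      ... | inC k   = subst₂ ℤ._<_ (sym v-ab) (sym (v-C (suc k))) (ℤP.+-monoʳ-< ρA (i<i+j ρB (C-positive k≤)))
      least : ∀ k → k ℕ.≤ ℓ → v a ℤ.≤ v k
      least k k≤ with region a b k
      ... | inA k<a = ℤP.<⇒≤ (first k k<a)
      ... | inB k≤b = subst₂ ℤ._≤_ (sym v-a) (sym (v-B k≤b)) (i≤i+j ρA (B-above _ k≤b))
      ... | inC k   = ℤP.<⇒≤ (subst (ℤ._< v (a ℕ.+ (b ℕ.+ suc k))) v-ab≡v-a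
                                      (last _ (ℕP.+-monoʳ-< a (ℕP.m<m+n b ℕ.z<s)) k≤))

    minima⇒pieces : IsFirstMinimum v ℓ a → IsLastMinimum v ℓ (a ℕ.+ b) →
      MinusHeads A × ZeroHeads B × PlusHeads C
    minima⇒pieces a-min ab-min = below , (ρB≡0 , B-above) , C-above
      where
      below : MinusHeads A
      below k k<a = subst₂ ℤ._<_ v-a (v-A (ℕP.<⇒≤ k<a)) (First.first a-min k k<a)
      ρB≡0 : ρB ≡ 0ℤ
      ρB≡0 = i+j≡i⇒j≡0 ρA (trans (sym v-ab) (trans (minima-agree a-min ab-min) v-a))
      B-above : ∀ k → k ℕ.≤ b → 0ℤ ℤ.≤ heads B k
      B-above k k≤b = +-cancelˡ-≤ ρA (subst₂ ℤ._≤_ (trans v-a (sym (ℤP.+-identityʳ ρA))) (v-B k≤b)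
                        (First.least a-min (a ℕ.+ k) (ℕP.≤-trans (ℕP.+-monoʳ-≤ a k≤b) (Last.bound ab-min))))
      C-above : PlusHeads C
      C-above zero _ nonempty = ⊥-elim (nonempty refl)
      C-above (suc k) k≤c _ = +-cancelˡ-< ρB (+-cancelˡ-< ρA (subst₂ ℤ._<_ v-ab+0 (v-C (suc k))
                                (Last.last ab-min _ (ℕP.+-monoʳ-< a (ℕP.m<m+n b ℕ.z<s)) bound)))
        where
        v-ab+0 : v (a ℕ.+ b) ≡ ρA + (ρB + 0ℤ)
        v-ab+0 = trans v-ab (cong (ρA +_) (sym (ℤP.+-identityʳ ρB)))
        bound : a ℕ.+ (b ℕ.+ suc k) ℕ.≤ ℓ
        bound = subst (a ℕ.+ (b ℕ.+ suc k) ℕ.≤_) (sym |ABC|) (ℕP.+-monoʳ-≤ a (ℕP.+-monoʳ-≤ b k≤c))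

  minus⇒H : ∀ {σ} → Hminus G σ → H σ
  minus⇒H = proj₁

  zero⇒H : ∀ {σ} → Hzero G σ → H σ
  zero⇒H = proj₁

  plus⇒H : ∀ {σ} → Hplus G σ → H σ
  plus⇒H = proj₁

  minusZero⇒H : ∀ {σ} → (Hminus G · Hzero G) σ → H σ
  minusZero⇒H (a , b , Ma , Zb , refl) = H-++ a b (minus⇒H Ma) (zero⇒H Zb)

  decomposable⇒H : ∀ {σ} → ((Hminus G · Hzero G) · Hplus G) σ → H σ
  decomposable⇒H (ab , c , MZab , Pc , refl) = H-++ ab c (minusZero⇒H MZab) (plus⇒H Pc)

  minus-[] : Hminus G []
  minus-[] = H-ε , inj₁ refl

  zero-[] : Hzero G []
  zero-[] = heads⇒zero [] (ρ-ε , λ { .0 ℕ.z≤n → ℤP.≤-reflexive (sym ρ-ε) })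

  plus-[] : Hplus G []
  plus-[] = heads⇒plus [] λ { .0 ℕ.z≤n nonempty → ⊥-elim (nonempty refl) }

  decompose : ∀ {σ} → H σ → ((Hminus G · Hzero G) · Hplus G) σ
  decompose {σ} Hσ with free-∃ σ Hσ
  ... | fs , fs! , refl with first-minimum {heads fs} (length fs) | last-minimum {heads fs} (length fs)
  ... | i , i-min | j , j-min with split₃ fs (first≤last i-min j-min) (Last.bound j-min)
  ... | A , B , C , refl , refl , refl with primes₃ A B fs!
  ... | A! , B! , C! with Pieces.minima⇒pieces A! B! C! i-min j-min
  ... | below , zero-heads , plus-heads =
    concat A ++ concat B , concat C , (concat A , concat B , heads⇒minus A! below , heads⇒zero B! zero-heads , refl) ,
    heads⇒plus C! plus-heads , trans (concat-++₃ A B C) (sym (LP.++-assoc (concat A) _ _))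

  decomposition-unique : ∀ {a b c a′ b′ c′} →
    Hminus G a → Hzero G b → Hplus G c → Hminus G a′ → Hzero G b′ → Hplus G c′ →
    a ++ b ++ c ≡ a′ ++ b′ ++ c′ → a ≡ a′ × b ≡ b′
  decomposition-unique {a} {b} {c} {a′} {b′} {c′} Ma Zb Pc Ma′ Zb′ Pc′ eq
    with free-∃ a (minus⇒H Ma) | free-∃ b (zero⇒H Zb) | free-∃ c (plus⇒H Pc)
       | free-∃ a′ (minus⇒H Ma′) | free-∃ b′ (zero⇒H Zb′) | free-∃ c′ (plus⇒H Pc′)
  ... | A , A! , refl | B , B! , refl | C , C! , refl | A′ , A′! , refl | B′ , B′! , refl | C′ , C′! , refl
    with Pieces.pieces⇒minima A! B! C! (minus⇒heads A! Ma) (zero⇒heads B! Zb) (plus⇒heads C! Pc)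
       | Pieces.pieces⇒minima A′! B′! C′! (minus⇒heads A′! Ma′) (zero⇒heads B′! Zb′) (plus⇒heads C′! Pc′)
  ... | A-first , AB-last | A′-first , A′B′-last = cong concat A≡A′ , cong concat B≡B′
    where
    same-factors : A′ ++ B′ ++ C′ ≡ A ++ B ++ C
    same-factors = factorization-unique (AllP.++⁺ A! (AllP.++⁺ B! C!))
      (AllP.++⁺ A′! (AllP.++⁺ B′! C′!) ,
       trans (concat-++₃ A′ B′ C′) (trans (sym eq) (sym (concat-++₃ A B C))))
    |A|≡ : length A ≡ length A′
    |A|≡ = first-minimum-unique A-first
             (subst (λ F → IsFirstMinimum (heads F) (length F) (length A′)) same-factors A′-first)
    |AB|≡ : length A ℕ.+ length B ≡ length A′ ℕ.+ length B′
    |AB|≡ = last-minimum-unique AB-last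
              (subst (λ F → IsLastMinimum (heads F) (length F) (length A′ ℕ.+ length B′)) same-factors A′B′-last)
    |B|≡ : length B ≡ length B′
    |B|≡ = ℕP.+-cancelˡ-≡ (length A) _ _ (trans |AB|≡ (cong (ℕ._+ length B′) (sym |A|≡)))
    A≡A′ : A ≡ A′
    A≡A′ = proj₁ (++-cancel-length {xs = A} {A′} |A|≡ (sym same-factors))
    BC≡B′C′ : B ++ C ≡ B′ ++ C′
    BC≡B′C′ = proj₂ (++-cancel-length {xs = A} {A′} |A|≡ (sym same-factors))
    B≡B′ : B ≡ B′
    B≡B′ = proj₁ (++-cancel-length {xs = B} {B′} |B|≡ BC≡B′C′)

  minus-zero-injective : ConcatInjective (Hminus G) (Hzero G)
  minus-zero-injective {a} {b} {a′} {b′} Ma Zb Ma′ Zb′ eq =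
    proj₁ (decomposition-unique Ma Zb plus-[] Ma′ Zb′ plus-[] (begin
      a ++ b ++ []     ≡⟨ cong (a ++_) (LP.++-identityʳ b) ⟩
      a ++ b           ≡⟨ eq ⟩
      a′ ++ b′         ≡⟨ cong (a′ ++_) (LP.++-identityʳ b′) ⟨
      a′ ++ b′ ++ []   ∎))
    where open ≡-Reasoning

  minusZero-plus-injective : ConcatInjective (Hminus G · Hzero G) (Hplus G)
  minusZero-plus-injective (a , b , Ma , Zb , refl) Pc (a′ , b′ , Ma′ , Zb′ , refl) Pc′ eq
    with decomposition-unique Ma Zb Pc Ma′ Zb′ Pc′
           (trans (sym (LP.++-assoc a b _)) (trans eq (LP.++-assoc a′ b′ _)))
  ... | refl , refl = refl

module GeneratingSeries {S : List Step} (G : GesselPair S) where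
  open GesselPair G
  open Decomposition G
  open Counting ρ

  stat-++ : ∀ {π τ} → H π → H τ → stat (π ++ τ) ≡ stat π ⊕ stat τ
  stat-++ {π} {τ} Hπ Hτ = cong₂ (λ e r → (proj₁ e , proj₂ e , r)) (endpoint-++ π τ) (ρ-++ π τ Hπ Hτ)

  enumerate : ∀ {P} f → IsΓ ρ P f → (∀ {σ} → P σ → H σ) → Enumeration P
  enumerate f Γf P⇒H = enumeration _≟ₛ_ S (λ Pσ → H⊆S* _ (P⇒H Pσ)) (IsΓ-decidable f Γf)

  []-initial : ∀ {n a b r} → 0 ≡ n → endpoint [] ≡ (a , b) → ρ [] ≡ r → IsInitialExp n a b r
  []-initial refl refl ρ[]≡r = refl , refl , refl , trans (sym ρ[]≡r) ρ-ε

  plus-positive : ∀ {π} → Hplus G π → π ≢ [] → 0ℤ ℤ.< ρ π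
  plus-positive {π} Pπ π≢[] with free-∃ π (plus⇒H Pπ)
  ... | fs , fs! , refl = subst (0ℤ ℤ.<_) (heads-length fs) (plus⇒heads fs! Pπ (length fs) ℕP.≤-refl all≢[])
    where
    all≢[] : concat (take (length fs) fs) ≢ []
    all≢[] = π≢[] ∘ trans (sym (cong concat (LP.take-all (length fs) fs ℕP.≤-refl)))

  minus-factor : ∀ f → IsΓ ρ (Hminus G) f → IsMinusFactor f
  minus-factor f Γf = IsΓ-initialOne f Γf ρ-ε minus-[] , support
    where
    support : ∀ n a b r → coeff (f n) a b r ≢ 0ℤ → IsInitialExp n a b r ⊎ r ℤ.< 0ℤ
    support n a b r coeff≢0 with IsΓ-support f Γf coeff≢0
    ... | [] , _ , |π| , end , ρπ = inj₁ ([]-initial |π| end ρπ)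
    ... | _ ∷ _ , (_ , inj₂ (ρπ<0 , _)) , _ , _ , refl = inj₂ ρπ<0

  zero-factor : ∀ f → IsΓ ρ (Hzero G) f → IsZeroFactor f
  zero-factor f Γf = IsΓ-initialOne f Γf ρ-ε zero-[] , support
    where
    support : ∀ n a b r → coeff (f n) a b r ≢ 0ℤ → r ≡ 0ℤ
    support n a b r coeff≢0 with IsΓ-support f Γf coeff≢0
    ... | _ , (_ , ρπ≡0 , _) , _ , _ , refl = ρπ≡0

  plus-factor : ∀ f → IsΓ ρ (Hplus G) f → IsPlusFactor f
  plus-factor f Γf = IsΓ-initialOne f Γf ρ-ε plus-[] , support
    where
    support : ∀ n a b r → coeff (f n) a b r ≢ 0ℤ → IsInitialExp n a b r ⊎ 0ℤ ℤ.< r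
    support n a b r coeff≢0 with IsΓ-support f Γf coeff≢0
    ... | [] , _ , |π| , end , ρπ = inj₁ ([]-initial |π| end ρπ)
    ... | _ ∷ _ , Pπ , _ , _ , refl = inj₂ (plus-positive Pπ λ ())

  decomposable-counted : ∀ h₋ h₀ h₊ →
    IsΓ ρ (Hminus G) h₋ → IsΓ ρ (Hzero G) h₀ → IsΓ ρ (Hplus G) h₊ →
    Σ (Enumeration ((Hminus G · Hzero G) · Hplus G)) λ E → Counts ((h₋ ⊛ h₀) ⊛ h₊) (enum E)
  decomposable-counted h₋ h₀ h₊ Γ₋ Γ₀ Γ₊ = E₋₀₊ , counts₋₀₊
    where
    E₋ : Enumeration (Hminus G)
    E₋ = enumerate h₋ Γ₋ minus⇒H
    E₀ : Enumeration (Hzero G)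
    E₀ = enumerate h₀ Γ₀ zero⇒H
    E₊ : Enumeration (Hplus G)
    E₊ = enumerate h₊ Γ₊ plus⇒H
    E₋₀ : Enumeration (Hminus G · Hzero G)
    E₋₀ = enumeration-⊙ E₋ E₀ minus-zero-injective
    E₋₀₊ : Enumeration ((Hminus G · Hzero G) · Hplus G)
    E₋₀₊ = enumeration-⊙ E₋₀ E₊ minusZero-plus-injective
    counts₋₀ : Counts (h₋ ⊛ h₀) (enum E₋₀)
    counts₋₀ = counts-⊛ E₋ E₀ (λ Ma Zb → stat-++ (minus⇒H Ma) (zero⇒H Zb))
                 (IsΓ-counts h₋ Γ₋ E₋) (IsΓ-counts h₀ Γ₀ E₀)
    counts₋₀₊ : Counts ((h₋ ⊛ h₀) ⊛ h₊) (enum E₋₀₊)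
    counts₋₀₊ = counts-⊛ E₋₀ E₊ (λ MZa Pc → stat-++ (minusZero⇒H MZa) (plus⇒H Pc))
                  counts₋₀ (IsΓ-counts h₊ Γ₊ E₊)

theorem3p3 : (S : List Step) (G : GesselPair S) (h h₋ h₀ h₊ : Series) →
    IsΓ (GesselPair.ρ G) (GesselPair.H G) h →
    IsΓ (GesselPair.ρ G) (Hminus G) h₋ →
    IsΓ (GesselPair.ρ G) (Hzero G) h₀ →
    IsΓ (GesselPair.ρ G) (Hplus G) h₊ →
    IsZFactorization h h₋ h₀ h₊
theorem3p3 S G h h₋ h₀ h₊ Γh Γ₋ Γ₀ Γ₊ with GeneratingSeries.decomposable-counted G h₋ h₀ h₊ Γ₋ Γ₀ Γ₊
... | E₋₀₊ , counts₋₀₊ =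
  minus-factor h₋ Γ₋ , zero-factor h₀ Γ₀ , plus-factor h₊ Γ₊ ,
  counts-≈ (IsΓ-counts h Γh Eh) counts₋₀₊ (enum-↭ Eh E₋₀₊ decompose decomposable⇒H)
  where
  open GesselPair G
  open Decomposition G
  open Counting ρ
  open GeneratingSeries G
  Eh : Enumeration H
  Eh = enumerate h Γh (λ Hσ → Hσ)
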